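{- Let $p$ be an odd prime and, for integers $i\ge0$ and digits $a\in\{0,1,\dots,p-1\}$, let $\Psi_{i,a}(x)=\prod_{j=1}^{ap^i}\big(p^{i+1-\nu_p(j)}x+\Theta_p(j)\big)$ (an empty product being $1$). Then, as congruences between integer-coefficient polynomials (coefficientwise): (a) $\Psi_{i,a}^{\,p^2-p}\equiv 1\pmod{p^2}$ for all $i\ge 0$ and all $a$; (b) $\Psi_{i,a}\equiv\Psi_{i+2,a}\pmod{p^2}$ for all $i\ge 1$ and all $a$.
   Context: For a positive integer $z$, $\nu_p(z)$ is the exponent of $p$ in $z$ and $\Theta_p(z)=z/p^{\nu_p(z)}$. -}

module Defs where

open import Data.Nat as ℕ using (ℕ; zero; suc; _∸_; _^_)
open import Data.Nat.DivMod using (_/_)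
open import Data.Nat.Divisibility using (_∣?_)
open import Data.Integer as ℤ using (ℤ; +_; 0ℤ; 1ℤ)
open import Data.Integer.Divisibility using () renaming (_∣_ to _∣ℤ_)
open import Data.List using (List; []; _∷_)
open import Relation.Nullary using (yes; no)

-- p-adic valuation ν_p(n) and p-free part Θ_p(n), computed by repeated
-- division by p (the fuel n suffices since p ≥ 2 for the first component).
-- For p ∈ {0,1} (never used) they are set to 0 and n respectively.
νf : ℕ → ℕ → ℕ → ℕ
νf zero _ _ = 0
νf (suc k) zero n = 0
νf (suc k) (suc zero) n = 0
νf (suc k) (suc (suc q)) zero = 0
νf (suc k) (suc (suc q)) (suc m) with suc (suc q) ∣? suc m
... | yes _ = suc (νf k (suc (suc q)) (suc m / suc (suc q)))
... | no _ = 0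

Θf : ℕ → ℕ → ℕ → ℕ
Θf zero _ n = n
Θf (suc k) zero n = n
Θf (suc k) (suc zero) n = n
Θf (suc k) (suc (suc q)) zero = zero
Θf (suc k) (suc (suc q)) (suc m) with suc (suc q) ∣? suc m
... | yes _ = Θf k (suc (suc q)) (suc m / suc (suc q))
... | no _ = suc m

ν : ℕ → ℕ → ℕ
ν p n = νf n p n

Θ : ℕ → ℕ → ℕ
Θ p n = Θf n p n

-- Polynomials with integer coefficients as coefficient lists (constant term first).
Poly : Set
Poly = List ℤ

_⊕_ : Poly → Poly → Poly
[] ⊕ g = g
(a ∷ f) ⊕ [] = a ∷ f
(a ∷ f) ⊕ (b ∷ g) = (a ℤ.+ b) ∷ (f ⊕ g)

scale : ℤ → Poly → Poly
scale c [] = []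
scale c (a ∷ f) = (c ℤ.* a) ∷ scale c f

_⊗_ : Poly → Poly → Poly
[] ⊗ g = []
(a ∷ f) ⊗ g = scale a g ⊕ (0ℤ ∷ (f ⊗ g))

one : Poly
one = 1ℤ ∷ []

_^ᴾ_ : Poly → ℕ → Poly
f ^ᴾ zero = one
f ^ᴾ suc n = f ⊗ (f ^ᴾ n)

coeff : Poly → ℕ → ℤ
coeff [] _ = 0ℤ
coeff (a ∷ f) zero = a
coeff (a ∷ f) (suc k) = coeff f k

_≡ᴾ_[mod_] : Poly → Poly → ℕ → Set
f ≡ᴾ g [mod m ] = ∀ k → (+ m) ∣ℤ (coeff f k ℤ.- coeff g k)

Ψprod : ℕ → ℕ → ℕ → Poly
Ψprod p i zero = one
Ψprod p i (suc j) =
  Ψprod p i j ⊗ ((+ Θ p (suc j)) ∷ (+ (p ^ (suc i ∸ ν p (suc j)))) ∷ [])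

Ψ : ℕ → ℕ → ℕ → Poly
Ψ p i a = Ψprod p i (a ℕ.* p ^ i)

-- Modulo p², a linear polynomial c + l x with p ∣ l behaves like the dual number c + l ε (ε² = 0):
-- the x²-coefficient of a product of two of them is divisible by p².  Every factor
-- p^(i+1-ν(j)) x + Θ(j) of Ψ_{i,a} has this shape since j < p^(i+1), so Ψ_{i,a} ≡ C + L x with p ∤ C, p ∣ L.
-- (a) (C + L x)^(p²-p) ≡ C^(p²-p) + (p²-p) C^(p²-p-1) L x, and C^(p(p-1)) ≡ 1 (mod p²) by lifting Fermat.
-- (b) Modulo p² the factors of Ψ_{i+1,a} with p ∤ j are the constants j, and those with j = p m are the
-- factors of Ψ_{i,a}.  So Ψ_{i+1,a} ≡ Ψ_{i,a} ∏_{m < a p^i} B_m, where the block B_m = ∏_{r=1}^{p-1} (p m + r)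
-- is ≡ W + p m S with W = (p-1)!.  If p ∣ M and p is odd then p ∣ M(M-1)/2, whence ∏_{m < M} B_m ≡ W^M.
-- Two steps therefore multiply Ψ_{i,a} (i ≥ 1) by W^(a p^(i-1) p (p+1)), and W^(p(p+1)) ≡ 1 (mod p²)
-- because W² ≡ 1 (mod p).

module Submission where

open import Defs

module _ where

  open import Data.Nat.Base as ℕ using (ℕ; zero; suc; z≤n; s≤s)
  import Data.Nat.Properties as ℕ
  open import Data.Integer.Base using (ℤ; +_; 0ℤ; 1ℤ; _+_; _-_; -_; _*_; _^_; ∣_∣)
  import Data.Integer.Properties as ℤ
  open import Data.Integer.Tactic.RingSolver using (solve-∀)
  import Data.Nat.Tactic.RingSolver as ℕ-Solver
  open import Data.Nat.Divisibility using (_∣_; _∣?_; divides; ∣-refl; ∣⇒≤; m∣m*n; ∣n⇒∣m*n; ∣m+n∣m⇒∣n)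
  open import Data.Nat.DivMod using (_/_; m/n<m; m*n/n≡m; m<n*o⇒m/o<n; m≥n⇒m/n>0)
  open import Data.Nat.Primality using (Prime; euclidsLemma)
  open import Data.Integer.DivMod using (_%ℕ_; _/ℕ_; n%ℕd<d; a≡a%ℕn+[a/ℕn]*n)
  import Data.Integer.Divisibility.Signed as Signed
  open import Data.List.Base using ([]; _∷_; drop)
  open import Data.Product.Base using (_×_; _,_; proj₁; proj₂; ∃)
  open import Data.Sum.Base as Sum using (_⊎_; inj₁; inj₂)
  open import Data.Empty using (⊥-elim)
  open import Data.Fin.Base as Fin using (Fin; toℕ; fromℕ<)
  import Data.Fin.Properties as Fin
  open import Data.Fin.Permutation using (Permutation; permutation)
  open import Function.Base using (_∘_; id)
  open import Function.Definitions using (Injective)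
  open import Relation.Nullary using (yes; no; ¬_)
  import Algebra.Properties.CommutativeMonoid.Sum as CommutativeMonoidSum
  open import Relation.Binary.Bundles using (Setoid)
  open import Relation.Binary.Structures using (IsEquivalence)
  open import Relation.Binary.PropositionalEquality
    using (_≡_; _≢_; refl; sym; trans; cong; cong₂; subst; module ≡-Reasoning)
  import Relation.Binary.Reasoning.Setoid as SetoidReasoning

  -- Congruence of integers

  infix 4 _≡_[mod_]

  record _≡_[mod_] (x y : ℤ) (m : ℕ) : Set where
    constructor ≡mod
    field m∣x-y : + m Signed.∣ x - y

  module _ {m : ℕ} where

    private
      via : ∀ {x y d} → x - y ≡ d → + m Signed.∣ d → x ≡ y [mod m ]
      via x-y≡d m∣d = ≡mod (subst (+ m Signed.∣_) (sym x-y≡d) m∣d)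

      open _≡_[mod_]

    ≡⇒≡mod : ∀ {x y} → x ≡ y → x ≡ y [mod m ]
    ≡⇒≡mod {x} refl = via (ℤ.+-inverseʳ x) (Signed.divides 0ℤ refl)

    ≡mod-refl : ∀ {x} → x ≡ x [mod m ]
    ≡mod-refl = ≡⇒≡mod refl

    ≡mod-sym : ∀ {x y} → x ≡ y [mod m ] → y ≡ x [mod m ]
    ≡mod-sym {x} {y} x≡y = via (identity x y) (Signed.∣m⇒∣-m (m∣x-y x≡y))
      where
      identity : ∀ x y → y - x ≡ - (x - y)
      identity = solve-∀

    ≡mod-trans : ∀ {x y z} → x ≡ y [mod m ] → y ≡ z [mod m ] → x ≡ z [mod m ]
    ≡mod-trans {x} {y} {z} x≡y y≡z =
      via (identity x y z) (Signed.∣m∣n⇒∣m+n (m∣x-y x≡y) (m∣x-y y≡z))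
      where
      identity : ∀ x y z → x - z ≡ (x - y) + (y - z)
      identity = solve-∀

    +-cong-mod : ∀ {x y u v} → x ≡ y [mod m ] → u ≡ v [mod m ] → x + u ≡ y + v [mod m ]
    +-cong-mod {x} {y} {u} {v} x≡y u≡v =
      via (identity x y u v) (Signed.∣m∣n⇒∣m+n (m∣x-y x≡y) (m∣x-y u≡v))
      where
      identity : ∀ x y u v → (x + u) - (y + v) ≡ (x - y) + (u - v)
      identity = solve-∀

    *-cong-mod : ∀ {x y u v} → x ≡ y [mod m ] → u ≡ v [mod m ] → x * u ≡ y * v [mod m ]
    *-cong-mod {x} {y} {u} {v} x≡y u≡v =
      via (identity x y u v)
          (Signed.∣m∣n⇒∣m+n (Signed.∣m⇒∣m*n u (m∣x-y x≡y)) (Signed.∣n⇒∣m*n y (m∣x-y u≡v)))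
      where
      identity : ∀ x y u v → x * u - y * v ≡ (x - y) * u + y * (u - v)
      identity = solve-∀

    *-congˡ-mod : ∀ x {u v} → u ≡ v [mod m ] → x * u ≡ x * v [mod m ]
    *-congˡ-mod x = *-cong-mod (≡mod-refl {x})

    *-congʳ-mod : ∀ x {u v} → u ≡ v [mod m ] → u * x ≡ v * x [mod m ]
    *-congʳ-mod x u≡v = *-cong-mod u≡v (≡mod-refl {x})

    ^-cong-mod : ∀ {x y} n → x ≡ y [mod m ] → x ^ n ≡ y ^ n [mod m ]
    ^-cong-mod zero    x≡y = ≡mod-refl
    ^-cong-mod (suc n) x≡y = *-cong-mod x≡y (^-cong-mod n x≡y)

    +-multiple-mod : ∀ x k → x + k * + m ≡ x [mod m ]
    +-multiple-mod x k = via (identity x k (+ m)) (Signed.divides k refl)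
      where
      identity : ∀ x k m → x + k * m - x ≡ k * m
      identity = solve-∀

    ≡mod-resp : ∀ {x x′ y y′} → x ≡ x′ → y ≡ y′ → x′ ≡ y′ [mod m ] → x ≡ y [mod m ]
    ≡mod-resp refl refl x′≡y′ = x′≡y′

    *-multiple≡0-mod : ∀ k → k * + m ≡ 0ℤ [mod m ]
    *-multiple≡0-mod k = ≡mod-resp (sym (ℤ.+-identityˡ (k * + m))) refl (+-multiple-mod 0ℤ k)

    ≡mod-isEquivalence : IsEquivalence (λ x y → x ≡ y [mod m ])
    ≡mod-isEquivalence = record { refl = ≡mod-refl ; sym = ≡mod-sym ; trans = ≡mod-trans }

  ≡mod-setoid : ℕ → Setoid _ _
  ≡mod-setoid m = record { isEquivalence = ≡mod-isEquivalence {m} }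

  module ≡mod-Reasoning (m : ℕ) = SetoidReasoning (≡mod-setoid m)

  module _ {m : ℕ} where

    ≡0-mod⇒∣ : ∀ {x} → x ≡ 0ℤ [mod m ] → m ∣ ∣ x ∣
    ≡0-mod⇒∣ {x} (≡mod m∣x-0) = subst (λ z → m ∣ ∣ z ∣) (ℤ.+-identityʳ x) (Signed.∣⇒∣ᵤ m∣x-0)

    ∣⇒≡0-mod : ∀ {x} → m ∣ ∣ x ∣ → x ≡ 0ℤ [mod m ]
    ∣⇒≡0-mod {x} m∣x = ≡mod (subst (+ m Signed.∣_) (sym (ℤ.+-identityʳ x)) (Signed.∣ᵤ⇒∣ m∣x))

    -≡0-mod : ∀ {x y} → x ≡ y [mod m ] → x - y ≡ 0ℤ [mod m ]
    -≡0-mod {x} {y} (≡mod m∣x-y) = ≡mod (subst (+ m Signed.∣_) (sym (ℤ.+-identityʳ (x - y))) m∣x-y)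

    -≡0-mod⁻ : ∀ {x y} → x - y ≡ 0ℤ [mod m ] → x ≡ y [mod m ]
    -≡0-mod⁻ {x} {y} (≡mod m∣x-y-0) = ≡mod (subst (+ m Signed.∣_) (ℤ.+-identityʳ (x - y)) m∣x-y-0)

    private
      ∣∧<⇒≡0 : ∀ {n} → m ∣ n → n ℕ.< m → n ≡ 0
      ∣∧<⇒≡0 {zero}  _   _   = refl
      ∣∧<⇒≡0 {suc n} m∣n n<m = ⊥-elim (ℕ.<⇒≱ n<m (∣⇒≤ m∣n))

      ≡mod∧≤⇒≡ : ∀ {j k} → k ℕ.≤ j → j ℕ.< m → + j ≡ + k [mod m ] → j ≡ k
      ≡mod∧≤⇒≡ {j} {k} k≤j j<m j≡k = ℕ.≤-antisym (ℕ.m∸n≡0⇒m≤n (∣∧<⇒≡0 m∣j∸k j∸k<m)) k≤j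
        where
        m∣j∸k : m ∣ j ℕ.∸ k
        m∣j∸k = ≡0-mod⇒∣ (≡mod-resp (sym (trans (ℤ.m-n≡m⊖n j k) (ℤ.⊖-≥ k≤j))) refl (-≡0-mod j≡k))
        j∸k<m : j ℕ.∸ k ℕ.< m
        j∸k<m = ℕ.≤-<-trans (ℕ.m∸n≤m j k) j<m

    ≡mod∧<⇒≡ : ∀ {j k} → j ℕ.< m → k ℕ.< m → + j ≡ + k [mod m ] → j ≡ k
    ≡mod∧<⇒≡ {j} {k} j<m k<m j≡k with ℕ.≤-total k j
    ... | inj₁ k≤j = ≡mod∧≤⇒≡ k≤j j<m j≡k
    ... | inj₂ j≤k = sym (≡mod∧≤⇒≡ j≤k k<m (≡mod-sym j≡k))

  ≡mod-%ℕ : ∀ x m .{{_ : ℕ.NonZero m}} → x ≡ + (x %ℕ m) [mod m ]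
  ≡mod-%ℕ x m = ≡mod-resp (a≡a%ℕn+[a/ℕn]*n x m) refl (+-multiple-mod (+ (x %ℕ m)) (x /ℕ m))

  module _ {p : ℕ} where

    +-multiple²-mod : ∀ x k → x + k * (+ p * + p) ≡ x [mod p ℕ.* p ]
    +-multiple²-mod x k = ≡mod-resp (cong (λ z → x + k * z) (sym (ℤ.pos-* p p))) refl (+-multiple-mod x k)

    *-≡0-mod² : ∀ {x y} → x ≡ 0ℤ [mod p ] → y ≡ 0ℤ [mod p ] → x * y ≡ 0ℤ [mod p ℕ.* p ]
    *-≡0-mod² {x} {y} (≡mod (Signed.divides a x≡ap)) (≡mod (Signed.divides b y≡bp)) =
      ≡mod (Signed.divides (a * b) (begin
        x * y - 0ℤ            ≡⟨ ℤ.+-identityʳ (x * y) ⟩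
        x * y                 ≡⟨ cong₂ _*_ (minus-zero x x≡ap) (minus-zero y y≡bp) ⟩
        (a * + p) * (b * + p) ≡⟨ identity a b (+ p) ⟩
        (a * b) * (+ p * + p) ≡⟨ cong ((a * b) *_) (ℤ.pos-* p p) ⟨
        (a * b) * + (p ℕ.* p) ∎))
      where
      open ≡-Reasoning
      minus-zero : ∀ z {w} → z - 0ℤ ≡ w → z ≡ w
      minus-zero z z-0≡w = trans (sym (ℤ.+-identityʳ z)) z-0≡w
      identity : ∀ a b p → (a * p) * (b * p) ≡ (a * b) * (p * p)
      identity = solve-∀

    private
      [1+tp]^n≡1+ntp : ∀ t n → (1ℤ + t * + p) ^ n ≡ 1ℤ + + n * t * + p [mod p ℕ.* p ]
      [1+tp]^n≡1+ntp t zero    = ≡⇒≡mod (base t (+ p))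
        where
        base : ∀ t p → 1ℤ ≡ 1ℤ + 0ℤ * t * p
        base = solve-∀
      [1+tp]^n≡1+ntp t (suc n) = begin
        (1ℤ + t * P) * (1ℤ + t * P) ^ n                        ≈⟨ *-congˡ-mod (1ℤ + t * P) ([1+tp]^n≡1+ntp t n) ⟩
        (1ℤ + t * P) * (1ℤ + + n * t * P)                      ≡⟨ expand t (+ n) P ⟩
        1ℤ + (1ℤ + + n) * t * P + (+ n * t * t) * (P * P)      ≈⟨ +-multiple²-mod (1ℤ + (1ℤ + + n) * t * P) (+ n * t * t) ⟩
        1ℤ + (1ℤ + + n) * t * P                                ≡⟨ cong (λ z → 1ℤ + z * t * P) (ℤ.pos-+ 1 n) ⟨
        1ℤ + + suc n * t * P                                   ∎
        where
        open ≡mod-Reasoning (p ℕ.* p)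
        P = + p
        expand : ∀ t n P → (1ℤ + t * P) * (1ℤ + n * t * P) ≡ 1ℤ + (1ℤ + n) * t * P + (n * t * t) * (P * P)
        expand = solve-∀

    ^-lift-mod : ∀ {x} → x ≡ 1ℤ [mod p ] → x ^ p ≡ 1ℤ [mod p ℕ.* p ]
    ^-lift-mod {x} (≡mod (Signed.divides t x-1≡tp)) = begin
      x ^ p                       ≡⟨ cong (_^ p) (trans (split x) (cong (λ z → 1ℤ + z) x-1≡tp)) ⟩
      (1ℤ + t * + p) ^ p          ≈⟨ [1+tp]^n≡1+ntp t p ⟩
      1ℤ + + p * t * + p          ≡⟨ regroup (+ p) t ⟩
      1ℤ + t * (+ p * + p)        ≈⟨ +-multiple²-mod 1ℤ t ⟩
      1ℤ                          ∎
      where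
      open ≡mod-Reasoning (p ℕ.* p)
      split : ∀ x → x ≡ 1ℤ + (x - 1ℤ)
      split = solve-∀
      regroup : ∀ P t → 1ℤ + P * t * P ≡ 1ℤ + t * (P * P)
      regroup = solve-∀

  -- Coefficientwise congruence of polynomials

  coeff-⊕ : ∀ f g k → coeff (f ⊕ g) k ≡ coeff f k + coeff g k
  coeff-⊕ []      g       k       = sym (ℤ.+-identityˡ _)
  coeff-⊕ (a ∷ f) []      k       = sym (ℤ.+-identityʳ _)
  coeff-⊕ (a ∷ f) (b ∷ g) zero    = refl
  coeff-⊕ (a ∷ f) (b ∷ g) (suc k) = coeff-⊕ f g k

  coeff-scale : ∀ c f k → coeff (scale c f) k ≡ c * coeff f k
  coeff-scale c []      k       = sym (ℤ.*-zeroʳ c)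
  coeff-scale c (a ∷ f) zero    = refl
  coeff-scale c (a ∷ f) (suc k) = coeff-scale c f k

  coeff-drop : ∀ f k → coeff (drop 1 f) k ≡ coeff f (suc k)
  coeff-drop []      k = refl
  coeff-drop (a ∷ f) k = refl

  coeff-⊗-zero : ∀ f g → coeff (f ⊗ g) 0 ≡ coeff f 0 * coeff g 0
  coeff-⊗-zero []      g = refl
  coeff-⊗-zero (a ∷ f) g = begin
    coeff (scale a g ⊕ (0ℤ ∷ (f ⊗ g))) 0 ≡⟨ coeff-⊕ (scale a g) _ 0 ⟩
    coeff (scale a g) 0 + 0ℤ              ≡⟨ ℤ.+-identityʳ _ ⟩
    coeff (scale a g) 0                   ≡⟨ coeff-scale a g 0 ⟩
    a * coeff g 0                         ∎
    where open ≡-Reasoning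

  coeff-⊗-suc : ∀ f g k →
    coeff (f ⊗ g) (suc k) ≡ coeff f 0 * coeff g (suc k) + coeff (drop 1 f ⊗ g) k
  coeff-⊗-suc []      g k = refl
  coeff-⊗-suc (a ∷ f) g k = trans (coeff-⊕ (scale a g) _ (suc k))
                                  (cong (_+ coeff (f ⊗ g) k) (coeff-scale a g (suc k)))

  infix 4 _≋_[mod_]

  record _≋_[mod_] (f g : Poly) (m : ℕ) : Set where
    constructor coeffwise
    field at : ∀ k → coeff f k ≡ coeff g k [mod m ]

  open _≋_[mod_]

  ≋⇒≡ᴾ : ∀ {f g m} → f ≋ g [mod m ] → f ≡ᴾ g [mod m ]
  ≋⇒≡ᴾ f≋g k = Signed.∣⇒∣ᵤ (_≡_[mod_].m∣x-y (at f≋g k))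

  module _ {m : ℕ} where

    ≋-refl : ∀ {f} → f ≋ f [mod m ]
    ≋-refl = coeffwise λ k → ≡mod-refl

    ≋-sym : ∀ {f g} → f ≋ g [mod m ] → g ≋ f [mod m ]
    ≋-sym f≋g = coeffwise λ k → ≡mod-sym (at f≋g k)

    ≋-trans : ∀ {f g h} → f ≋ g [mod m ] → g ≋ h [mod m ] → f ≋ h [mod m ]
    ≋-trans f≋g g≋h = coeffwise λ k → ≡mod-trans (at f≋g k) (at g≋h k)

    ⊗-cong-mod : ∀ {f f′ g g′} → f ≋ f′ [mod m ] → g ≋ g′ [mod m ] → (f ⊗ g) ≋ (f′ ⊗ g′) [mod m ]
    ⊗-cong-mod f≋f′ g≋g′ = coeffwise (coefficient f≋f′ g≋g′)
      where
      coefficient : ∀ {f f′ g g′} → f ≋ f′ [mod m ] → g ≋ g′ [mod m ] →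
                    ∀ k → coeff (f ⊗ g) k ≡ coeff (f′ ⊗ g′) k [mod m ]
      coefficient {f} {f′} {g} {g′} f≋f′ g≋g′ zero =
        ≡mod-resp (coeff-⊗-zero f g) (coeff-⊗-zero f′ g′) (*-cong-mod (at f≋f′ 0) (at g≋g′ 0))
      coefficient {f} {f′} {g} {g′} f≋f′ g≋g′ (suc k) =
        ≡mod-resp (coeff-⊗-suc f g k) (coeff-⊗-suc f′ g′ k)
          (+-cong-mod (*-cong-mod (at f≋f′ 0) (at g≋g′ (suc k)))
                      (coefficient {drop 1 f} {drop 1 f′} (coeffwise drop-cong) g≋g′ k))
        where
        drop-cong : ∀ j → coeff (drop 1 f) j ≡ coeff (drop 1 f′) j [mod m ]
        drop-cong j = ≡mod-resp (coeff-drop f j) (coeff-drop f′ j) (at f≋f′ (suc j))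

    ^ᴾ-cong-mod : ∀ {f g} n → f ≋ g [mod m ] → (f ^ᴾ n) ≋ (g ^ᴾ n) [mod m ]
    ^ᴾ-cong-mod zero    f≋g = ≋-refl
    ^ᴾ-cong-mod (suc n) f≋g = ⊗-cong-mod f≋g (^ᴾ-cong-mod n f≋g)

  ∏ : ℕ → (ℕ → ℤ) → ℤ
  ∏ zero    F = 1ℤ
  ∏ (suc n) F = ∏ n F * F n

  ∏-cong-mod : ∀ {m} n {F G} → (∀ k → k ℕ.< n → F k ≡ G k [mod m ]) → ∏ n F ≡ ∏ n G [mod m ]
  ∏-cong-mod zero    F≡G = ≡mod-refl
  ∏-cong-mod (suc n) F≡G =
    *-cong-mod (∏-cong-mod n λ k k<n → F≡G k (ℕ.m<n⇒m<1+n k<n)) (F≡G n ℕ.≤-refl)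

  ∏-*-distrib : ∀ n F G → ∏ n (λ k → F k * G k) ≡ ∏ n F * ∏ n G
  ∏-*-distrib zero    F G = refl
  ∏-*-distrib (suc n) F G = begin
    ∏ n (λ k → F k * G k) * (F n * G n) ≡⟨ cong (_* (F n * G n)) (∏-*-distrib n F G) ⟩
    ∏ n F * ∏ n G * (F n * G n)         ≡⟨ interchange (∏ n F) (∏ n G) (F n) (G n) ⟩
    ∏ n F * F n * (∏ n G * G n)         ∎
    where
    open ≡-Reasoning
    interchange : ∀ a b c d → a * b * (c * d) ≡ a * c * (b * d)
    interchange = solve-∀

  ∏-const : ∀ n x → ∏ n (λ _ → x) ≡ x ^ n
  ∏-const zero    x = refl
  ∏-const (suc n) x = trans (cong (_* x) (∏-const n x)) (ℤ.*-comm (x ^ n) x)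

  ∏-^ : ∀ n F e → ∏ n (λ k → F k ^ e) ≡ ∏ n F ^ e
  ∏-^ n F zero    = trans (∏-const n 1ℤ) (ℤ.^-zeroˡ n)
  ∏-^ n F (suc e) = trans (∏-*-distrib n F (λ k → F k ^ e)) (cong (∏ n F *_) (∏-^ n F e))

  triangle : ℕ → ℕ
  triangle zero    = 0
  triangle (suc n) = triangle n ℕ.+ suc n

  2*triangle : ∀ n → 2 ℕ.* triangle n ≡ n ℕ.* suc n
  2*triangle zero    = refl
  2*triangle (suc n) = begin
    2 ℕ.* (triangle n ℕ.+ suc n)          ≡⟨ ℕ.*-distribˡ-+ 2 (triangle n) (suc n) ⟩
    2 ℕ.* triangle n ℕ.+ 2 ℕ.* suc n      ≡⟨ cong (ℕ._+ 2 ℕ.* suc n) (2*triangle n) ⟩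
    n ℕ.* suc n ℕ.+ 2 ℕ.* suc n           ≡⟨ ℕ.*-distribʳ-+ (suc n) n 2 ⟨
    (n ℕ.+ 2) ℕ.* suc n                   ≡⟨ cong (ℕ._* suc n) (ℕ.+-comm n 2) ⟩
    suc (suc n) ℕ.* suc n                 ≡⟨ ℕ.*-comm (suc (suc n)) (suc n) ⟩
    suc n ℕ.* suc (suc n)                 ∎
    where open ≡-Reasoning

  -- The coefficient of ε in ∏ r (λ t → a t + b t ε) when ε² = 0.
  firstOrder : (ℕ → ℤ) → (ℕ → ℤ) → ℕ → ℤ
  firstOrder a b zero    = 0ℤ
  firstOrder a b (suc r) = firstOrder a b r * a r + ∏ r a * b r

  module _ {p : ℕ} where

    ∏-firstOrder-mod : ∀ r a b → ∏ r (λ t → a t + + p * b t) ≡ ∏ r a + + p * firstOrder a b r [mod p ℕ.* p ]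
    ∏-firstOrder-mod zero    a b = ≡⇒≡mod (no-correction (+ p))
      where
      no-correction : ∀ P → 1ℤ ≡ 1ℤ + P * 0ℤ
      no-correction = solve-∀
    ∏-firstOrder-mod (suc r) a b = begin
      ∏ r (λ t → a t + P * b t) * (a r + P * b r)  ≈⟨ *-congʳ-mod (a r + P * b r) (∏-firstOrder-mod r a b) ⟩
      (∏ r a + P * E) * (a r + P * b r)            ≡⟨ expand (∏ r a) E (a r) (b r) P ⟩
      A′ + (E * b r) * (P * P)                     ≈⟨ +-multiple²-mod {p} A′ (E * b r) ⟩
      A′                                           ∎
      where
      open ≡mod-Reasoning (p ℕ.* p)
      P = + p
      E = firstOrder a b r
      A′ = ∏ r a * a r + P * (E * a r + ∏ r a * b r)
      expand : ∀ A E a b P → (A + P * E) * (a + P * b) ≡ A * a + P * (E * a + A * b) + (E * b) * (P * P)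
      expand = solve-∀

  firstOrder-scale : ∀ r a {b b′} c → (∀ t → b′ t ≡ c * b t) → firstOrder a b′ r ≡ c * firstOrder a b r
  firstOrder-scale zero    a c b′≡cb = sym (ℤ.*-zeroʳ c)
  firstOrder-scale (suc r) a {b} {b′} c b′≡cb = begin
    firstOrder a b′ r * a r + ∏ r a * b′ r
      ≡⟨ cong₂ (λ u v → u * a r + ∏ r a * v) (firstOrder-scale r a c b′≡cb) (b′≡cb r) ⟩
    c * firstOrder a b r * a r + ∏ r a * (c * b r)
      ≡⟨ factor c (firstOrder a b r) (a r) (∏ r a) (b r) ⟩
    c * (firstOrder a b r * a r + ∏ r a * b r)
      ∎
    where
    open ≡-Reasoning
    factor : ∀ c E a A b → c * E * a + A * (c * b) ≡ c * (E * a + A * b)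
    factor = solve-∀

  firstOrder-const : ∀ m x → firstOrder (λ _ → x) (λ t → + t) (suc m) ≡ x ^ m * + triangle m
  firstOrder-const zero    x = base x
    where
    base : ∀ x → 0ℤ * x + 1ℤ * 0ℤ ≡ 1ℤ * 0ℤ
    base = solve-∀
  firstOrder-const (suc m) x = begin
    firstOrder (λ _ → x) (λ t → + t) (suc m) * x + ∏ (suc m) (λ _ → x) * + suc m
      ≡⟨ cong₂ (λ u v → u * x + v * + suc m) (firstOrder-const m x) (∏-const (suc m) x) ⟩
    x ^ m * + triangle m * x + x * x ^ m * + suc m
      ≡⟨ collect x (x ^ m) (+ triangle m) (+ suc m) ⟩
    x * x ^ m * (+ triangle m + + suc m)
      ≡⟨ cong (x * x ^ m *_) (ℤ.pos-+ (triangle m) (suc m)) ⟨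
    x * x ^ m * + triangle (suc m)
      ∎
    where
    open ≡-Reasoning
    collect : ∀ x X T n → X * T * x + x * X * n ≡ x * X * (T + n)
    collect = solve-∀

  module FinProduct = CommutativeMonoidSum ℤ.*-1-commutativeMonoid

  ∏ᶠ : ∀ {n} → (Fin n → ℤ) → ℤ
  ∏ᶠ = FinProduct.sum

  ∏≡∏ᶠ : ∀ n F → ∏ n F ≡ ∏ᶠ {n} (F ∘ toℕ)
  ∏≡∏ᶠ zero    F = refl
  ∏≡∏ᶠ (suc n) F = begin
    ∏ n F * F n
      ≡⟨ cong (_* F n) (∏≡∏ᶠ n F) ⟩
    ∏ᶠ {n} (F ∘ toℕ) * F n
      ≡⟨ cong₂ _*_ (FinProduct.sum-cong-≗ {n} λ i → cong F (sym (Fin.toℕ-inject₁ i)))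
                   (cong F (sym (Fin.toℕ-fromℕ n))) ⟩
    ∏ᶠ {n} (F ∘ toℕ ∘ Fin.inject₁) * F (toℕ (Fin.fromℕ n))
      ≡⟨ FinProduct.sum-init-last {n} (F ∘ toℕ) ⟨
    ∏ᶠ {suc n} (F ∘ toℕ)
      ∎
    where open ≡-Reasoning

  injective⇒surjective : ∀ {n} {σ : Fin n → Fin n} → Injective _≡_ _≡_ σ → ∀ j → ∃ λ i → σ i ≡ j
  injective⇒surjective {suc n} {σ} σ-injective j with Fin.any? (λ i → σ i Fin.≟ j)
  ... | yes hit  = hit
  ... | no  miss = ⊥-elim (ℕ.1+n≰n (Fin.injective⇒≤ punched-injective))
    where
    missed : ∀ i → j ≢ σ i
    missed i j≡σi = miss (i , sym j≡σi)
    punched : Fin (suc n) → Fin n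
    punched i = Fin.punchOut (missed i)
    punched-injective : Injective _≡_ _≡_ punched
    punched-injective {x} {y} eq = σ-injective (Fin.punchOut-injective (missed x) (missed y) eq)

  injective⇒permutation : ∀ {n} {σ : Fin n → Fin n} → Injective _≡_ _≡_ σ → Permutation n n
  injective⇒permutation {σ = σ} σ-injective =
    permutation σ (proj₁ ∘ preimage) (proj₂ ∘ preimage) (λ i → σ-injective (proj₂ (preimage (σ i))))
    where preimage = injective⇒surjective σ-injective

  ∏ᶠ-cong-mod : ∀ {m n} {f g : Fin n → ℤ} → (∀ i → f i ≡ g i [mod m ]) → ∏ᶠ f ≡ ∏ᶠ g [mod m ]
  ∏ᶠ-cong-mod {n = zero}  f≡g = ≡mod-refl
  ∏ᶠ-cong-mod {n = suc n} f≡g = *-cong-mod (f≡g Fin.zero) (∏ᶠ-cong-mod (f≡g ∘ Fin.suc))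

  ∏ᶠ-injective : ∀ {n} (f : Fin n → ℤ) {σ : Fin n → Fin n} → Injective _≡_ _≡_ σ → ∏ᶠ (f ∘ σ) ≡ ∏ᶠ f
  ∏ᶠ-injective f σ-injective = sym (FinProduct.sum-permute f (injective⇒permutation σ-injective))

  -- Dual numbers

  -- (c , l) stands for the linear polynomial c + l x, multiplied modulo x².

  Dual : Set
  Dual = ℤ × ℤ

  infixl 7 _·_

  _·_ : Dual → Dual → Dual
  (c , l) · (t , s) = (c * t , c * s + l * t)

  1ᴰ : Dual
  1ᴰ = (1ℤ , 0ℤ)

  linear : Dual → Poly
  linear (c , l) = c ∷ l ∷ []

  ·-assoc : ∀ d e f → (d · e) · f ≡ d · (e · f)
  ·-assoc (a , b) (c , d) (e , f) = cong₂ _,_ (first a c e) (second a b c d e f)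
    where
    first : ∀ a c e → (a * c) * e ≡ a * (c * e)
    first = solve-∀
    second : ∀ a b c d e f → (a * c) * f + (a * d + b * c) * e ≡ a * (c * f + d * e) + b * (c * e)
    second = solve-∀

  ·-identityʳ : ∀ d → d · 1ᴰ ≡ d
  ·-identityʳ (c , l) = cong₂ _,_ (first c) (second c l)
    where
    first : ∀ c → c * 1ℤ ≡ c
    first = solve-∀
    second : ∀ c l → c * 0ℤ + l * 1ℤ ≡ l
    second = solve-∀

  ·-scalar : ∀ a b → (a , 0ℤ) · (b , 0ℤ) ≡ (a * b , 0ℤ)
  ·-scalar a b = cong (a * b ,_) (no-ε a b)
    where
    no-ε : ∀ a b → a * 0ℤ + 0ℤ * b ≡ 0ℤ
    no-ε = solve-∀

  ·-scalar-interchange : ∀ d e a b → (d · (a , 0ℤ)) · ((b , 0ℤ) · e) ≡ (d · e) · (a * b , 0ℤ)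
  ·-scalar-interchange (c , l) (t , s) a b = cong₂ _,_ (first c t a b) (second c l t s a b)
    where
    first : ∀ c t a b → (c * a) * (b * t) ≡ (c * t) * (a * b)
    first = solve-∀
    second : ∀ c l t s a b → (c * a) * (b * s + 0ℤ * t) + (c * 0ℤ + l * a) * (b * t)
                           ≡ (c * t) * 0ℤ + (c * s + l * t) * (a * b)
    second = solve-∀

  infix 4 _≈ᴰ_[mod_]

  data _≈ᴰ_[mod_] : Dual → Dual → ℕ → Set where
    _,_ : ∀ {c c′ l l′ m} → c ≡ c′ [mod m ] → l ≡ l′ [mod m ] → (c , l) ≈ᴰ (c′ , l′) [mod m ]

  module _ {m : ℕ} where

    ≡⇒≈ᴰ : ∀ {d e} → d ≡ e → d ≈ᴰ e [mod m ]
    ≡⇒≈ᴰ {c , l} refl = ≡mod-refl , ≡mod-refl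

    ≈ᴰ-refl : ∀ {d} → d ≈ᴰ d [mod m ]
    ≈ᴰ-refl = ≡⇒≈ᴰ refl

    ≈ᴰ-sym : ∀ {d e} → d ≈ᴰ e [mod m ] → e ≈ᴰ d [mod m ]
    ≈ᴰ-sym (c , l) = ≡mod-sym c , ≡mod-sym l

    ≈ᴰ-trans : ∀ {d e f} → d ≈ᴰ e [mod m ] → e ≈ᴰ f [mod m ] → d ≈ᴰ f [mod m ]
    ≈ᴰ-trans (c , l) (c′ , l′) = ≡mod-trans c c′ , ≡mod-trans l l′

    ·-cong-mod : ∀ {d d′ e e′} → d ≈ᴰ d′ [mod m ] → e ≈ᴰ e′ [mod m ] → d · e ≈ᴰ d′ · e′ [mod m ]
    ·-cong-mod (c , l) (t , s) = *-cong-mod c t , +-cong-mod (*-cong-mod c s) (*-cong-mod l t)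

    linear-cong : ∀ {d e} → d ≈ᴰ e [mod m ] → linear d ≋ linear e [mod m ]
    linear-cong (c , l) = coeffwise λ { zero → c ; (suc zero) → l ; (suc (suc k)) → ≡mod-refl }

  ≈ᴰ-setoid : ℕ → Setoid _ _
  ≈ᴰ-setoid m = record
    { Carrier       = Dual
    ; _≈_           = λ d e → d ≈ᴰ e [mod m ]
    ; isEquivalence = record { refl = ≈ᴰ-refl ; sym = ≈ᴰ-sym ; trans = ≈ᴰ-trans }
    }

  module ≈ᴰ-Reasoning (m : ℕ) = SetoidReasoning (≈ᴰ-setoid m)

  linear-1ᴰ : ∀ {m} → one ≋ linear 1ᴰ [mod m ]
  linear-1ᴰ = coeffwise λ { zero → ≡mod-refl ; (suc zero) → ≡mod-refl ; (suc (suc k)) → ≡mod-refl }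

  ∏ᴰ : ℕ → (ℕ → Dual) → Dual
  ∏ᴰ zero    F = 1ᴰ
  ∏ᴰ (suc n) F = ∏ᴰ n F · F n

  ∏ᴰ-+ : ∀ n k F → ∏ᴰ (n ℕ.+ k) F ≡ ∏ᴰ n F · ∏ᴰ k (λ t → F (n ℕ.+ t))
  ∏ᴰ-+ n zero    F = trans (cong (λ m → ∏ᴰ m F) (ℕ.+-identityʳ n)) (sym (·-identityʳ (∏ᴰ n F)))
  ∏ᴰ-+ n (suc k) F = begin
    ∏ᴰ (n ℕ.+ suc k) F                                 ≡⟨ cong (λ m → ∏ᴰ m F) (ℕ.+-suc n k) ⟩
    ∏ᴰ (n ℕ.+ k) F · F (n ℕ.+ k)                       ≡⟨ cong (_· F (n ℕ.+ k)) (∏ᴰ-+ n k F) ⟩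
    ∏ᴰ n F · ∏ᴰ k (λ t → F (n ℕ.+ t)) · F (n ℕ.+ k)    ≡⟨ ·-assoc (∏ᴰ n F) _ _ ⟩
    ∏ᴰ n F · (∏ᴰ k (λ t → F (n ℕ.+ t)) · F (n ℕ.+ k))  ∎
    where open ≡-Reasoning

  ∏ᴰ-scalar : ∀ {m} r {F G} → (∀ t → t ℕ.< r → F t ≈ᴰ (G t , 0ℤ) [mod m ]) → ∏ᴰ r F ≈ᴰ (∏ r G , 0ℤ) [mod m ]
  ∏ᴰ-scalar zero    F≈G = ≈ᴰ-refl
  ∏ᴰ-scalar (suc r) {F} {G} F≈G =
    ≈ᴰ-trans (·-cong-mod (∏ᴰ-scalar r λ t t<r → F≈G t (ℕ.m<n⇒m<1+n t<r)) (F≈G r ℕ.≤-refl))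
             (≡⇒≈ᴰ (·-scalar (∏ r G) (G r)))

  infixr 8 _^ᴰ_

  _^ᴰ_ : Dual → ℕ → Dual
  d ^ᴰ zero  = 1ᴰ
  d ^ᴰ suc n = d · d ^ᴰ n

  ^ᴰ-proj₁ : ∀ c l n → proj₁ ((c , l) ^ᴰ n) ≡ c ^ n
  ^ᴰ-proj₁ c l zero    = refl
  ^ᴰ-proj₁ c l (suc n) = cong (c *_) (^ᴰ-proj₁ c l n)

  ^ᴰ-proj₂ : ∀ c l n → proj₂ ((c , l) ^ᴰ suc n) ≡ + suc n * c ^ n * l
  ^ᴰ-proj₂ c l zero    = base c l
    where
    base : ∀ c l → c * 0ℤ + l * 1ℤ ≡ 1ℤ * 1ℤ * l
    base = solve-∀
  ^ᴰ-proj₂ c l (suc n) = begin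
    c * proj₂ ((c , l) ^ᴰ suc n) + l * proj₁ ((c , l) ^ᴰ suc n)
      ≡⟨ cong₂ (λ u v → c * u + l * v) (^ᴰ-proj₂ c l n) (^ᴰ-proj₁ c l (suc n)) ⟩
    c * (+ suc n * c ^ n * l) + l * (c * c ^ n)
      ≡⟨ collect c l (+ suc n) (c ^ n) ⟩
    (1ℤ + + suc n) * (c * c ^ n) * l
      ≡⟨ cong (λ z → z * (c * c ^ n) * l) (ℤ.pos-+ 1 (suc n)) ⟨
    + suc (suc n) * (c * c ^ n) * l
      ∎
    where
    open ≡-Reasoning
    collect : ∀ c l n C → c * (n * C * l) + l * (c * C) ≡ (1ℤ + n) * (c * C) * l
    collect = solve-∀

  module _ {p : ℕ} where

    ·-proj₂≡0 : ∀ {d e} → proj₂ d ≡ 0ℤ [mod p ] → proj₂ e ≡ 0ℤ [mod p ] → proj₂ (d · e) ≡ 0ℤ [mod p ]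
    ·-proj₂≡0 {c , l} {t , s} p∣l p∣s =
      ≡mod-resp refl (sym (ℤ.+-identityʳ 0ℤ))
        (+-cong-mod (≡mod-resp refl (sym (ℤ.*-zeroʳ c)) (*-congˡ-mod c p∣s))
                    (≡mod-resp refl (sym (ℤ.*-zeroˡ t)) (*-congʳ-mod t p∣l)))

    linear-⊗ : ∀ {d e} → proj₂ d ≡ 0ℤ [mod p ] → proj₂ e ≡ 0ℤ [mod p ] →
               (linear d ⊗ linear e) ≋ linear (d · e) [mod p ℕ.* p ]
    linear-⊗ {c , l} {t , s} p∣l p∣s = coeffwise λ
      { zero                → ≡⇒≡mod (ℤ.+-identityʳ _)
      ; (suc zero)          → ≡⇒≡mod (cong (λ z → c * s + z) (ℤ.+-identityʳ _))
      ; (suc (suc zero))    → *-≡0-mod² p∣l p∣s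
      ; (suc (suc (suc k))) → ≡mod-refl
      }

    linear-^ᴾ : ∀ {d} n → proj₂ d ≡ 0ℤ [mod p ] →
                (linear d ^ᴾ n) ≋ linear (d ^ᴰ n) [mod p ℕ.* p ] × proj₂ (d ^ᴰ n) ≡ 0ℤ [mod p ]
    linear-^ᴾ zero    p∣l = linear-1ᴰ , ≡mod-refl
    linear-^ᴾ {d} (suc n) p∣l =
      ≋-trans (⊗-cong-mod (≋-refl {f = linear d}) (proj₁ IH)) (linear-⊗ {d} {d ^ᴰ n} p∣l (proj₂ IH)) ,
      ·-proj₂≡0 {d} {d ^ᴰ n} p∣l (proj₂ IH)
      where IH = linear-^ᴾ n p∣l

  -- Arithmetic modulo a prime

  module _ {p : ℕ} (prime : Prime p) where

    *-≡0-mod : ∀ {x y} → x * y ≡ 0ℤ [mod p ] → x ≡ 0ℤ [mod p ] ⊎ y ≡ 0ℤ [mod p ]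
    *-≡0-mod {x} {y} xy≡0 = Sum.map ∣⇒≡0-mod ∣⇒≡0-mod
      (euclidsLemma ∣ x ∣ ∣ y ∣ prime (subst (p ∣_) (ℤ.abs-* x y) (≡0-mod⇒∣ xy≡0)))

    *-cancelˡ-mod : ∀ {w a b} → ¬ w ≡ 0ℤ [mod p ] → w * a ≡ w * b [mod p ] → a ≡ b [mod p ]
    *-cancelˡ-mod {w} {a} {b} w≢0 wa≡wb =
      Sum.[ ⊥-elim ∘ w≢0 , -≡0-mod⁻ ] (*-≡0-mod (≡mod-resp (factor w a b) refl (-≡0-mod wa≡wb)))
      where
      factor : ∀ w a b → w * (a - b) ≡ w * a - w * b
      factor = solve-∀

  module Units (q : ℕ) (prime : Prime (suc (suc q))) where

    p : ℕ
    p = suc (suc q)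

    1≢0-mod : ¬ 1ℤ ≡ 0ℤ [mod p ]
    1≢0-mod 1≡0 with ≡mod∧<⇒≡ {j = 1} {k = 0} (s≤s (s≤s z≤n)) (s≤s z≤n) 1≡0
    ... | ()

    suc≢0-mod : ∀ {k} → k ℕ.< suc q → ¬ + suc k ≡ 0ℤ [mod p ]
    suc≢0-mod k<1+q k≡0 with ≡mod∧<⇒≡ {k = 0} (s≤s k<1+q) (s≤s z≤n) k≡0
    ... | ()

    ∏-≢0-mod : ∀ n {F} → (∀ k → k ℕ.< n → ¬ F k ≡ 0ℤ [mod p ]) → ¬ ∏ n F ≡ 0ℤ [mod p ]
    ∏-≢0-mod zero    F≢0 = 1≢0-mod
    ∏-≢0-mod (suc n) F≢0 ∏≡0 =
      Sum.[ ∏-≢0-mod n (λ k k<n → F≢0 k (ℕ.m<n⇒m<1+n k<n)) , F≢0 n ℕ.≤-refl ] (*-≡0-mod prime ∏≡0)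

    W : ℤ
    W = ∏ (suc q) (λ k → + suc k)

    W≢0 : ¬ W ≡ 0ℤ [mod p ]
    W≢0 = ∏-≢0-mod (suc q) (λ k → suc≢0-mod)

    unitResidue : ∀ x → ¬ x ≡ 0ℤ [mod p ] → ∃ λ (i : Fin (suc q)) → x ≡ + suc (toℕ i) [mod p ]
    unitResidue x x≢0 with x %ℕ p in eq
    ... | zero  = ⊥-elim (x≢0 (subst (λ n → x ≡ + n [mod p ]) eq (≡mod-%ℕ x p)))
    ... | suc r = fromℕ< r<1+q , subst (λ n → x ≡ + n [mod p ]) residue (≡mod-%ℕ x p)
      where
      r<1+q : r ℕ.< suc q
      r<1+q = ℕ.s<s⁻¹ (subst (ℕ._< p) eq (n%ℕd<d x p))
      residue : x %ℕ p ≡ suc (toℕ (fromℕ< r<1+q))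
      residue = trans eq (cong suc (sym (Fin.toℕ-fromℕ< r<1+q)))

    ∏-unitResidues : ∀ (F : ℕ → ℤ) → (∀ k → k ℕ.< suc q → ¬ F k ≡ 0ℤ [mod p ]) →
                     (∀ {j k} → j ℕ.< suc q → k ℕ.< suc q → F j ≡ F k [mod p ] → j ≡ k) →
                     ∏ (suc q) F ≡ W [mod p ]
    ∏-unitResidues F F≢0 F-injective = begin
      ∏ (suc q) F          ≡⟨ ∏≡∏ᶠ (suc q) F ⟩
      ∏ᶠ {suc q} (F ∘ toℕ) ≈⟨ ∏ᶠ-cong-mod (proj₂ ∘ residue) ⟩
      ∏ᶠ (unit ∘ σ)        ≡⟨ ∏ᶠ-injective unit σ-injective ⟩
      ∏ᶠ unit              ≡⟨ ∏≡∏ᶠ (suc q) (λ k → + suc k) ⟨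
      W                    ∎
      where
      open ≡mod-Reasoning p
      unit : Fin (suc q) → ℤ
      unit i = + suc (toℕ i)
      residue : ∀ i → ∃ λ j → F (toℕ i) ≡ unit j [mod p ]
      residue i = unitResidue (F (toℕ i)) (F≢0 (toℕ i) (Fin.toℕ<n i))
      σ : Fin (suc q) → Fin (suc q)
      σ = proj₁ ∘ residue
      σ-injective : Injective _≡_ _≡_ σ
      σ-injective {i} {j} σi≡σj = Fin.toℕ-injective (F-injective (Fin.toℕ<n i) (Fin.toℕ<n j)
        (≡mod-trans (proj₂ (residue i)) (≡mod-resp (cong unit σi≡σj) refl (≡mod-sym (proj₂ (residue j))))))

    fermat : ∀ {x} → ¬ x ≡ 0ℤ [mod p ] → x ^ suc q ≡ 1ℤ [mod p ]
    fermat {x} x≢0 = *-cancelˡ-mod prime W≢0 (begin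
      W * x ^ suc q                    ≡⟨ ℤ.*-comm W (x ^ suc q) ⟩
      x ^ suc q * W                    ≡⟨ cong (_* W) (∏-const (suc q) x) ⟨
      ∏ (suc q) (λ _ → x) * W          ≡⟨ ∏-*-distrib (suc q) (λ _ → x) (λ k → + suc k) ⟨
      ∏ (suc q) (λ k → x * + suc k)    ≈⟨ ∏-unitResidues (λ k → x * + suc k) x·≢0 x·-injective ⟩
      W                                ≡⟨ ℤ.*-identityʳ W ⟨
      W * 1ℤ                           ∎)
      where
      open ≡mod-Reasoning p
      x·≢0 : ∀ k → k ℕ.< suc q → ¬ x * + suc k ≡ 0ℤ [mod p ]
      x·≢0 k k<1+q xk≡0 = Sum.[ x≢0 , suc≢0-mod k<1+q ] (*-≡0-mod prime xk≡0)
      x·-injective : ∀ {j k} → j ℕ.< suc q → k ℕ.< suc q → x * + suc j ≡ x * + suc k [mod p ] → j ≡ k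
      x·-injective j<1+q k<1+q xj≡xk =
        ℕ.suc-injective (≡mod∧<⇒≡ (s≤s j<1+q) (s≤s k<1+q) (*-cancelˡ-mod prime x≢0 xj≡xk))

    -- Wilson's theorem up to sign: inversion permutes the units, and k⁻¹ ≡ k ^ q.
    W*W≡1 : W * W ≡ 1ℤ [mod p ]
    W*W≡1 = begin
      W * W                            ≈⟨ *-congˡ-mod W W^q≡W ⟨
      W * W ^ q                        ≈⟨ fermat W≢0 ⟩
      1ℤ                               ∎
      where
      open ≡mod-Reasoning p
      unit : ℕ → ℤ
      unit k = + suc k
      inverse≢0 : ∀ k → k ℕ.< suc q → ¬ unit k ^ q ≡ 0ℤ [mod p ]
      inverse≢0 k k<1+q k^q≡0 = 1≢0-mod (begin
        1ℤ                  ≈⟨ fermat (suc≢0-mod k<1+q) ⟨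
        unit k * unit k ^ q ≈⟨ *-congˡ-mod (unit k) k^q≡0 ⟩
        unit k * 0ℤ         ≡⟨ ℤ.*-zeroʳ (unit k) ⟩
        0ℤ                  ∎)
      inverse-injective : ∀ {j k} → j ℕ.< suc q → k ℕ.< suc q → unit j ^ q ≡ unit k ^ q [mod p ] → j ≡ k
      inverse-injective {j} {k} j<1+q k<1+q j^q≡k^q = ℕ.suc-injective (≡mod∧<⇒≡ (s≤s j<1+q) (s≤s k<1+q) (begin
        unit j                              ≡⟨ ℤ.*-identityʳ (unit j) ⟨
        unit j * 1ℤ                         ≈⟨ *-congˡ-mod (unit j) (fermat (suc≢0-mod k<1+q)) ⟨
        unit j * (unit k * unit k ^ q)      ≈⟨ *-congˡ-mod (unit j) (*-congˡ-mod (unit k) j^q≡k^q) ⟨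
        unit j * (unit k * unit j ^ q)      ≡⟨ swap (unit j) (unit k) (unit j ^ q) ⟩
        unit k * (unit j * unit j ^ q)      ≈⟨ *-congˡ-mod (unit k) (fermat (suc≢0-mod j<1+q)) ⟩
        unit k * 1ℤ                         ≡⟨ ℤ.*-identityʳ (unit k) ⟩
        unit k                              ∎))
        where
        swap : ∀ a b c → a * (b * c) ≡ b * (a * c)
        swap = solve-∀
      W^q≡W : W ^ q ≡ W [mod p ]
      W^q≡W = ≡mod-resp (sym (∏-^ (suc q) unit q)) refl (∏-unitResidues (λ k → unit k ^ q) inverse≢0 inverse-injective)

    euler : ∀ {x} → ¬ x ≡ 0ℤ [mod p ] → x ^ (suc q ℕ.* p) ≡ 1ℤ [mod p ℕ.* p ]
    euler {x} x≢0 = ≡mod-resp (sym (ℤ.^-*-assoc x (suc q) p)) refl (^-lift-mod (fermat x≢0))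

    ^ᴰ-euler : ∀ {c l} → ¬ c ≡ 0ℤ [mod p ] → l ≡ 0ℤ [mod p ] → (c , l) ^ᴰ (suc q ℕ.* p) ≈ᴰ 1ᴰ [mod p ℕ.* p ]
    ^ᴰ-euler {c} {l} c≢0 p∣l =
      ≡mod-resp (^ᴰ-proj₁ c l (suc q ℕ.* p)) refl (euler c≢0) ,
      ≡mod-resp (trans (^ᴰ-proj₂ c l n) (cong (λ z → z * c ^ n * l) (ℤ.pos-* (suc q) p))) refl
                (*-≡0-mod² (*-congʳ-mod (c ^ n) (*-multiple≡0-mod (+ suc q))) p∣l)
      where
      -- suc q * p reduces to suc n
      n : ℕ
      n = suc q ℕ.+ q ℕ.* p

    W^[p*[p+1]]≡1 : W ^ (p ℕ.* suc p) ≡ 1ℤ [mod p ℕ.* p ]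
    W^[p*[p+1]]≡1 = ≡mod-resp W^[p*[p+1]]≡[W^[p+1]]^p refl (^-lift-mod W^[p+1]≡1)
      where
      W^[p*[p+1]]≡[W^[p+1]]^p : W ^ (p ℕ.* suc p) ≡ (W ^ suc p) ^ p
      W^[p*[p+1]]≡[W^[p+1]]^p = trans (cong (W ^_) (ℕ.*-comm p (suc p))) (sym (ℤ.^-*-assoc W (suc p) p))
      W^[p+1]≡1 : W ^ suc p ≡ 1ℤ [mod p ]
      W^[p+1]≡1 = begin
        W * (W * W ^ suc q)   ≈⟨ *-congˡ-mod W (*-congˡ-mod W (fermat W≢0)) ⟩
        W * (W * 1ℤ)          ≡⟨ cong (W *_) (ℤ.*-identityʳ W) ⟩
        W * W                 ≈⟨ W*W≡1 ⟩
        1ℤ                    ∎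
        where open ≡mod-Reasoning p

  -- The p-adic valuation and the p-free part

  module Valuation (q : ℕ) where

    private
      p : ℕ
      p = suc (suc q)

      quotient≤ : ∀ {m k} → m ℕ.≤ k → suc m / p ℕ.≤ k
      quotient≤ {m} m≤k = ℕ.≤-trans (ℕ.≤-pred (m/n<m (suc m) p (s≤s (s≤s z≤n)))) m≤k

    νf-fuel : ∀ k k′ n → n ℕ.≤ k → n ℕ.≤ k′ → νf k p n ≡ νf k′ p n
    νf-fuel zero    zero     zero    _         _          = refl
    νf-fuel zero    (suc k′) zero    _         _          = refl
    νf-fuel (suc k) zero     zero    _         _          = refl
    νf-fuel (suc k) (suc k′) zero    _         _          = refl
    νf-fuel (suc k) (suc k′) (suc m) (s≤s m≤k) (s≤s m≤k′) with p ∣? suc m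
    ... | yes _ = cong suc (νf-fuel k k′ (suc m / p) (quotient≤ m≤k) (quotient≤ m≤k′))
    ... | no  _ = refl

    Θf-fuel : ∀ k k′ n → n ℕ.≤ k → n ℕ.≤ k′ → Θf k p n ≡ Θf k′ p n
    Θf-fuel zero    zero     zero    _         _          = refl
    Θf-fuel zero    (suc k′) zero    _         _          = refl
    Θf-fuel (suc k) zero     zero    _         _          = refl
    Θf-fuel (suc k) (suc k′) zero    _         _          = refl
    Θf-fuel (suc k) (suc k′) (suc m) (s≤s m≤k) (s≤s m≤k′) with p ∣? suc m
    ... | yes _ = Θf-fuel k k′ (suc m / p) (quotient≤ m≤k) (quotient≤ m≤k′)
    ... | no  _ = refl

    νf-∣ : ∀ k n → p ∣ suc n → νf (suc k) p (suc n) ≡ suc (νf k p (suc n / p))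
    νf-∣ k n p∣n with p ∣? suc n
    ... | yes _   = refl
    ... | no  p∤n = ⊥-elim (p∤n p∣n)

    Θf-∣ : ∀ k n → p ∣ suc n → Θf (suc k) p (suc n) ≡ Θf k p (suc n / p)
    Θf-∣ k n p∣n with p ∣? suc n
    ... | yes _   = refl
    ... | no  p∤n = ⊥-elim (p∤n p∣n)

    ν-∤ : ∀ n → ¬ p ∣ suc n → ν p (suc n) ≡ 0
    ν-∤ n p∤n with p ∣? suc n
    ... | yes p∣n = ⊥-elim (p∤n p∣n)
    ... | no  _   = refl

    Θ-∤ : ∀ n → ¬ p ∣ suc n → Θ p (suc n) ≡ suc n
    Θ-∤ n p∤n with p ∣? suc n
    ... | yes p∣n = ⊥-elim (p∤n p∣n)
    ... | no  _   = refl

    private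
      -- p * suc m reduces to suc (m + suc q * suc m); this is the fuel left after one division.
      fuel : ℕ → ℕ
      fuel m = m ℕ.+ suc q ℕ.* suc m

      1+m≤fuel : ∀ m → suc m ℕ.≤ fuel m
      1+m≤fuel m = ℕ.≤-trans (ℕ.m≤n+m (suc m) m) (ℕ.+-monoʳ-≤ m (ℕ.m≤m+n (suc m) (q ℕ.* suc m)))

      p∣p*[1+m] : ∀ m → p ∣ p ℕ.* suc m
      p∣p*[1+m] m = divides (suc m) (ℕ.*-comm p (suc m))

      p*[1+m]/p : ∀ m → p ℕ.* suc m / p ≡ suc m
      p*[1+m]/p m = trans (cong (_/ p) (ℕ.*-comm p (suc m))) (m*n/n≡m (suc m) p)

    ν-p* : ∀ m → ν p (p ℕ.* suc m) ≡ suc (ν p (suc m))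
    ν-p* m = begin
      ν p (p ℕ.* suc m)                         ≡⟨ νf-∣ (fuel m) (fuel m) (p∣p*[1+m] m) ⟩
      suc (νf (fuel m) p (p ℕ.* suc m / p))     ≡⟨ cong (λ n → suc (νf (fuel m) p n)) (p*[1+m]/p m) ⟩
      suc (νf (fuel m) p (suc m))               ≡⟨ cong suc (νf-fuel (fuel m) (suc m) (suc m) (1+m≤fuel m) ℕ.≤-refl) ⟩
      suc (ν p (suc m))                         ∎
      where open ≡-Reasoning

    Θ-p* : ∀ m → Θ p (p ℕ.* suc m) ≡ Θ p (suc m)
    Θ-p* m = begin
      Θ p (p ℕ.* suc m)                   ≡⟨ Θf-∣ (fuel m) (fuel m) (p∣p*[1+m] m) ⟩
      Θf (fuel m) p (p ℕ.* suc m / p)     ≡⟨ cong (Θf (fuel m) p) (p*[1+m]/p m) ⟩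
      Θf (fuel m) p (suc m)               ≡⟨ Θf-fuel (fuel m) (suc m) (suc m) (1+m≤fuel m) ℕ.≤-refl ⟩
      Θ p (suc m)                         ∎
      where open ≡-Reasoning

    νf-< : ∀ k i n → n ℕ.< p ℕ.^ suc i → νf k p n ℕ.≤ i
    νf-< zero    i       n       _ = z≤n
    νf-< (suc k) i       zero    _ = z≤n
    νf-< (suc k) i       (suc m) n<p^[1+i] with p ∣? suc m
    ... | no  _   = z≤n
    νf-< (suc k) zero    (suc m) n<p | yes p∣n =
      ⊥-elim (ℕ.<⇒≱ n<p (ℕ.≤-trans (ℕ.≤-reflexive (ℕ.*-identityʳ p)) (∣⇒≤ p∣n)))
    νf-< (suc k) (suc i) (suc m) n<p^[2+i] | yes _ =
      s≤s (νf-< k i (suc m / p) (m<n*o⇒m/o<n (subst (suc m ℕ.<_) (ℕ.*-comm p (p ℕ.^ suc i)) n<p^[2+i])))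

    ν-< : ∀ {i n} → n ℕ.< p ℕ.^ suc i → ν p n ℕ.≤ i
    ν-< {i} {n} = νf-< n i n

    Θf-∤ : ∀ k n → 0 ℕ.< n → n ℕ.≤ k → ¬ p ∣ Θf k p n
    Θf-∤ (suc k) (suc m) _ (s≤s m≤k) with p ∣? suc m
    ... | no  p∤n = p∤n
    ... | yes p∣n = Θf-∤ k (suc m / p) (m≥n⇒m/n>0 (∣⇒≤ p∣n)) (quotient≤ m≤k)

    p∤Θ : ∀ n → ¬ p ∣ Θ p (suc n)
    p∤Θ n = Θf-∤ (suc n) (suc n) (s≤s z≤n) ℕ.≤-refl

  -- Ψ modulo p²

  module PsiModSquare (q : ℕ) (prime : Prime (suc (suc q))) where

    open Units q prime
    open Valuation q

    factor : ℕ → ℕ → Dual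
    factor i j = (+ Θ p j , + (p ℕ.^ (suc i ℕ.∸ ν p j)))

    ψ : ℕ → ℕ → Dual
    ψ i n = ∏ᴰ n (λ j → factor i (suc j))

    factor-proj₂≡0 : ∀ {i j} → j ℕ.< p ℕ.^ suc i → proj₂ (factor i j) ≡ 0ℤ [mod p ]
    factor-proj₂≡0 {i} {j} j<p^[1+i] =
      subst (λ e → + (p ℕ.^ e) ≡ 0ℤ [mod p ]) (sym (ℕ.+-∸-assoc 1 (ν-< j<p^[1+i])))
            (∣⇒≡0-mod (m∣m*n (p ℕ.^ (i ℕ.∸ ν p j))))

    factor-∤ : ∀ i n → ¬ p ∣ suc n → factor i (suc n) ≡ (+ suc n , + (p ℕ.^ suc i))
    factor-∤ i n p∤1+n = cong₂ _,_ (cong +_ (Θ-∤ n p∤1+n)) (cong (λ v → + (p ℕ.^ (suc i ℕ.∸ v))) (ν-∤ n p∤1+n))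

    factor-p* : ∀ i m → factor (suc i) (p ℕ.* suc m) ≡ factor i (suc m)
    factor-p* i m = cong₂ _,_ (cong +_ (Θ-p* m)) (cong (λ v → + (p ℕ.^ (suc (suc i) ℕ.∸ v))) (ν-p* m))

    ψ-unit : ∀ i n → ¬ proj₁ (ψ i n) ≡ 0ℤ [mod p ]
    ψ-unit i zero    = 1≢0-mod
    ψ-unit i (suc n) = Sum.[ ψ-unit i n , p∤Θ n ∘ ≡0-mod⇒∣ ] ∘ *-≡0-mod prime

    Ψprod≋ψ : ∀ i n → n ℕ.< p ℕ.^ suc i →
              Ψprod p i n ≋ linear (ψ i n) [mod p ℕ.* p ] × proj₂ (ψ i n) ≡ 0ℤ [mod p ]
    Ψprod≋ψ i zero    _          = linear-1ᴰ , ≡mod-refl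
    Ψprod≋ψ i (suc n) n<p^[1+i] =
      ≋-trans (⊗-cong-mod (proj₁ IH) ≋-refl) (linear-⊗ {d = ψ i n} (proj₂ IH) p∣s) ,
      ·-proj₂≡0 {d = ψ i n} (proj₂ IH) p∣s
      where
      IH = Ψprod≋ψ i n (ℕ.<-trans (ℕ.n<1+n n) n<p^[1+i])
      p∣s = factor-proj₂≡0 n<p^[1+i]

    Ψ≋ψ : ∀ i {a} → a ℕ.< p → Ψ p i a ≋ linear (ψ i (a ℕ.* p ℕ.^ i)) [mod p ℕ.* p ] ×
                                proj₂ (ψ i (a ℕ.* p ℕ.^ i)) ≡ 0ℤ [mod p ]
    Ψ≋ψ i {a} a<p = Ψprod≋ψ i (a ℕ.* p ℕ.^ i) (ℕ.*-monoˡ-< (p ℕ.^ i) {{ℕ.m^n≢0 p i}} a<p)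

    Ψ^[p²-p]≋1 : ∀ i {a} → a ℕ.< p → (Ψ p i a ^ᴾ (suc q ℕ.* p)) ≋ one [mod p ℕ.* p ]
    Ψ^[p²-p]≋1 i {a} a<p =
      ≋-trans (^ᴾ-cong-mod (suc q ℕ.* p) (proj₁ Ψ≋))
        (≋-trans (proj₁ (linear-^ᴾ (suc q ℕ.* p) (proj₂ Ψ≋)))
          (≋-trans (linear-cong (^ᴰ-euler (ψ-unit i (a ℕ.* p ℕ.^ i)) (proj₂ Ψ≋))) (≋-sym linear-1ᴰ)))
      where Ψ≋ = Ψ≋ψ i a<p

    block : ℕ → ℤ
    block m = ∏ (suc q) (λ t → + suc (p ℕ.* m ℕ.+ t))

    Q : ℕ → ℤ
    Q M = ∏ M block

    factor-in-block : ∀ i m t → t ℕ.< suc q →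
                      factor (suc i) (suc (p ℕ.* m ℕ.+ t)) ≈ᴰ (+ suc (p ℕ.* m ℕ.+ t) , 0ℤ) [mod p ℕ.* p ]
    factor-in-block i m t t<1+q =
      ≈ᴰ-trans (≡⇒≈ᴰ (factor-∤ (suc i) (p ℕ.* m ℕ.+ t) p∤)) (≡mod-refl , p²∣p^[2+i])
      where
      p²∣p^[2+i] : + (p ℕ.^ suc (suc i)) ≡ 0ℤ [mod p ℕ.* p ]
      p²∣p^[2+i] = ∣⇒≡0-mod (subst (p ℕ.* p ∣_) (ℕ.*-assoc p p (p ℕ.^ i)) (m∣m*n (p ℕ.^ i)))
      p∤ : ¬ p ∣ suc (p ℕ.* m ℕ.+ t)
      p∤ p∣ = ℕ.<⇒≱ (s≤s t<1+q) (∣⇒≤ (∣m+n∣m⇒∣n (subst (p ∣_) (sym (ℕ.+-suc (p ℕ.* m) t)) p∣) (m∣m*n m)))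

    ψ-step : ∀ i m → ψ (suc i) (p ℕ.* m) ≈ᴰ ψ i m · (Q m , 0ℤ) [mod p ℕ.* p ]
    ψ-step i zero    = ≡⇒≈ᴰ (trans (cong (ψ (suc i)) (ℕ.*-zeroʳ p)) (sym (·-identityʳ 1ᴰ)))
    ψ-step i (suc m) = begin
      ψ (suc i) (p ℕ.* suc m)
        ≡⟨ cong (ψ (suc i)) p[1+m]≡pm+p ⟩
      ψ (suc i) (p ℕ.* m ℕ.+ p)
        ≡⟨ ∏ᴰ-+ (p ℕ.* m) p F ⟩
      ψ (suc i) (p ℕ.* m) · (∏ᴰ (suc q) G · G (suc q))
        ≈⟨ ·-cong-mod (ψ-step i m) (·-cong-mod block-dual (≡⇒≈ᴰ last)) ⟩
      ψ i m · (Q m , 0ℤ) · ((block m , 0ℤ) · factor i (suc m))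
        ≡⟨ ·-scalar-interchange (ψ i m) (factor i (suc m)) (Q m) (block m) ⟩
      ψ i (suc m) · (Q (suc m) , 0ℤ)
        ∎
      where
      open ≈ᴰ-Reasoning (p ℕ.* p)
      F : ℕ → Dual
      F j = factor (suc i) (suc j)
      G : ℕ → Dual
      G t = F (p ℕ.* m ℕ.+ t)
      p[1+m]≡pm+p : p ℕ.* suc m ≡ p ℕ.* m ℕ.+ p
      p[1+m]≡pm+p = trans (ℕ.*-suc p m) (ℕ.+-comm p (p ℕ.* m))
      block-dual : ∏ᴰ (suc q) G ≈ᴰ (block m , 0ℤ) [mod p ℕ.* p ]
      block-dual = ∏ᴰ-scalar (suc q) (λ t → factor-in-block i m t)
      last : G (suc q) ≡ factor i (suc m)
      last = trans (cong (factor (suc i)) (trans (cong suc (ℕ.+-comm (p ℕ.* m) (suc q))) (sym (ℕ.*-suc p m))))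
                   (factor-p* i m)

    S : ℤ
    S = firstOrder (λ t → + suc t) (λ _ → 1ℤ) (suc q)

    block-term : ∀ m t → + suc (p ℕ.* m ℕ.+ t) ≡ + suc t + + p * + m
    block-term m t = begin
      + suc (p ℕ.* m ℕ.+ t)     ≡⟨ cong +_ (trans (sym (ℕ.+-suc (p ℕ.* m) t)) (ℕ.+-comm (p ℕ.* m) (suc t))) ⟩
      + (suc t ℕ.+ p ℕ.* m)     ≡⟨ ℤ.pos-+ (suc t) (p ℕ.* m) ⟩
      + suc t + + (p ℕ.* m)     ≡⟨ cong (λ z → + suc t + z) (ℤ.pos-* p m) ⟩
      + suc t + + p * + m       ∎
      where open ≡-Reasoning

    block-linear : ∀ m → block m ≡ W + + p * (+ m * S) [mod p ℕ.* p ]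
    block-linear m = begin
      block m
        ≈⟨ ∏-cong-mod (suc q) (λ t _ → ≡⇒≡mod (block-term m t)) ⟩
      ∏ (suc q) (λ t → + suc t + + p * + m)
        ≈⟨ ∏-firstOrder-mod (suc q) (λ t → + suc t) (λ _ → + m) ⟩
      W + + p * firstOrder (λ t → + suc t) (λ _ → + m) (suc q)
        ≡⟨ cong (λ z → W + + p * z) (firstOrder-scale (suc q) _ (+ m) (λ _ → sym (ℤ.*-identityʳ (+ m)))) ⟩
      W + + p * (+ m * S)
        ∎
      where
      open ≡mod-Reasoning (p ℕ.* p)

    p∣triangle : q ≢ 0 → ∀ m → p ∣ suc m → p ∣ triangle m
    p∣triangle q≢0 m p∣1+m = Sum.[ ⊥-elim ∘ p∤2 , id ]
      (euclidsLemma 2 (triangle m) prime (subst (p ∣_) (sym (2*triangle m)) (∣n⇒∣m*n m p∣1+m)))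
      where
      p∤2 : ¬ p ∣ 2
      p∤2 p∣2 = q≢0 (ℕ.n≤0⇒n≡0 (ℕ.s≤s⁻¹ (ℕ.s≤s⁻¹ (∣⇒≤ p∣2))))

    -- Q M ≡ W ^ M + p S W ^ (M - 1) (M choose 2), and the odd prime p divides M choose 2 when p ∣ M.
    Q≡W^ : q ≢ 0 → ∀ M → p ∣ M → Q M ≡ W ^ M [mod p ℕ.* p ]
    Q≡W^ q≢0 zero    _     = ≡mod-refl
    Q≡W^ q≢0 (suc m) p∣1+m = begin
      ∏ (suc m) block
        ≈⟨ ∏-cong-mod (suc m) (λ k _ → block-linear k) ⟩
      ∏ (suc m) (λ k → W + + p * (+ k * S))
        ≈⟨ ∏-firstOrder-mod (suc m) (λ _ → W) (λ k → + k * S) ⟩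
      ∏ (suc m) (λ _ → W) + + p * firstOrder (λ _ → W) (λ k → + k * S) (suc m)
        ≡⟨ cong₂ (λ u v → u + + p * v) (∏-const (suc m) W) first-order ⟩
      W ^ suc m + + p * (S * (W ^ m * + triangle m))
        ≈⟨ +-cong-mod (≡mod-refl {x = W ^ suc m}) (*-≡0-mod² p≡0 X≡0) ⟩
      W ^ suc m + 0ℤ
        ≡⟨ ℤ.+-identityʳ (W ^ suc m) ⟩
      W ^ suc m
        ∎
      where
      open ≡mod-Reasoning (p ℕ.* p)
      first-order : firstOrder (λ _ → W) (λ k → + k * S) (suc m) ≡ S * (W ^ m * + triangle m)
      first-order = trans (firstOrder-scale (suc m) (λ _ → W) S (λ k → ℤ.*-comm (+ k) S))
                          (cong (S *_) (firstOrder-const m W))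
      p≡0 : + p ≡ 0ℤ [mod p ]
      p≡0 = ∣⇒≡0-mod ∣-refl
      X≡0 : S * (W ^ m * + triangle m) ≡ 0ℤ [mod p ]
      X≡0 = ≡mod-resp refl (sym (trans (cong (S *_) (ℤ.*-zeroʳ (W ^ m))) (ℤ.*-zeroʳ S)))
              (*-congˡ-mod S (*-congˡ-mod (W ^ m) (∣⇒≡0-mod (p∣triangle q≢0 m p∣1+m))))

    Q[pM]*Q[p²M]≡1 : q ≢ 0 → ∀ M → Q (p ℕ.* M) * Q (p ℕ.* (p ℕ.* M)) ≡ 1ℤ [mod p ℕ.* p ]
    Q[pM]*Q[p²M]≡1 q≢0 M = begin
      Q (p ℕ.* M) * Q (p ℕ.* (p ℕ.* M))        ≈⟨ *-cong-mod (Q≡W^ q≢0 _ (m∣m*n M))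
                                                            (Q≡W^ q≢0 _ (m∣m*n (p ℕ.* M))) ⟩
      W ^ (p ℕ.* M) * W ^ (p ℕ.* (p ℕ.* M))    ≡⟨ ℤ.^-distribˡ-+-* W (p ℕ.* M) (p ℕ.* (p ℕ.* M)) ⟨
      W ^ (p ℕ.* M ℕ.+ p ℕ.* (p ℕ.* M))        ≡⟨ cong (W ^_) (exponent p M) ⟩
      W ^ (p ℕ.* suc p ℕ.* M)                  ≡⟨ ℤ.^-*-assoc W (p ℕ.* suc p) M ⟨
      (W ^ (p ℕ.* suc p)) ^ M                  ≈⟨ ^-cong-mod M W^[p*[p+1]]≡1 ⟩
      1ℤ ^ M                                   ≡⟨ ℤ.^-zeroˡ M ⟩
      1ℤ                                       ∎
      where
      open ≡mod-Reasoning (p ℕ.* p)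
      exponent : ∀ p M → p ℕ.* M ℕ.+ p ℕ.* (p ℕ.* M) ≡ p ℕ.* (1 ℕ.+ p) ℕ.* M
      exponent = ℕ-Solver.solve-∀

    ψ-period : q ≢ 0 → ∀ i M → ψ (3 ℕ.+ i) (p ℕ.* (p ℕ.* (p ℕ.* M))) ≈ᴰ ψ (1 ℕ.+ i) (p ℕ.* M) [mod p ℕ.* p ]
    ψ-period q≢0 i M = begin
      ψ (3 ℕ.+ i) (p ℕ.* p²M)          ≈⟨ ψ-step (2 ℕ.+ i) p²M ⟩
      ψ (2 ℕ.+ i) p²M · (Q₂ , 0ℤ)      ≈⟨ ·-cong-mod (ψ-step (1 ℕ.+ i) pM) ≈ᴰ-refl ⟩
      X · (Q₁ , 0ℤ) · (Q₂ , 0ℤ)        ≡⟨ ·-assoc X (Q₁ , 0ℤ) (Q₂ , 0ℤ) ⟩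
      X · ((Q₁ , 0ℤ) · (Q₂ , 0ℤ))      ≈⟨ ·-cong-mod (≈ᴰ-refl {d = X}) Q₁Q₂≈1 ⟩
      X · 1ᴰ                           ≡⟨ ·-identityʳ X ⟩
      X                                ∎
      where
      open ≈ᴰ-Reasoning (p ℕ.* p)
      pM p²M : ℕ
      pM  = p ℕ.* M
      p²M = p ℕ.* pM
      X : Dual
      X = ψ (1 ℕ.+ i) pM
      Q₁ Q₂ : ℤ
      Q₁ = Q pM
      Q₂ = Q p²M
      Q₁Q₂≈1 : (Q₁ , 0ℤ) · (Q₂ , 0ℤ) ≈ᴰ 1ᴰ [mod p ℕ.* p ]
      Q₁Q₂≈1 = ≈ᴰ-trans (≡⇒≈ᴰ (·-scalar Q₁ Q₂)) (Q[pM]*Q[p²M]≡1 q≢0 M , ≡mod-refl)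

    Ψ-period : q ≢ 0 → ∀ i {a} → a ℕ.< p → Ψ p (1 ℕ.+ i) a ≋ Ψ p (3 ℕ.+ i) a [mod p ℕ.* p ]
    Ψ-period q≢0 i {a} a<p =
      ≋-trans (Ψ≋ψ-at (1 ℕ.+ i) (a*p^[1+k] i))
        (≋-trans (linear-cong (≈ᴰ-sym (ψ-period q≢0 i M))) (≋-sym (Ψ≋ψ-at (3 ℕ.+ i) exponents)))
      where
      Ψ≋ψ-at : ∀ j {n} → a ℕ.* p ℕ.^ j ≡ n → Ψ p j a ≋ linear (ψ j n) [mod p ℕ.* p ]
      Ψ≋ψ-at j refl = proj₁ (Ψ≋ψ j a<p)
      M : ℕ
      M = a ℕ.* p ℕ.^ i
      a*p^[1+k] : ∀ k → a ℕ.* p ℕ.^ suc k ≡ p ℕ.* (a ℕ.* p ℕ.^ k)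
      a*p^[1+k] k = swap a p (p ℕ.^ k)
        where
        swap : ∀ a p x → a ℕ.* (p ℕ.* x) ≡ p ℕ.* (a ℕ.* x)
        swap = ℕ-Solver.solve-∀
      exponents : a ℕ.* p ℕ.^ (3 ℕ.+ i) ≡ p ℕ.* (p ℕ.* (p ℕ.* M))
      exponents = trans (a*p^[1+k] (2 ℕ.+ i))
                        (cong (p ℕ.*_) (trans (a*p^[1+k] (1 ℕ.+ i)) (cong (p ℕ.*_) (a*p^[1+k] i))))

open import Data.Nat.Base using (ℕ; zero; suc; _<_; _≤_; _*_; _∸_; _+_)
open import Data.Nat.Properties using (*-identityˡ; *-distribʳ-∸; +-comm)
open import Data.Nat.Primality using (Prime; ¬prime[0]; ¬prime[1])
open import Data.Product.Base using (_×_; _,_)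
open import Data.Empty using (⊥-elim)
open import Relation.Binary.PropositionalEquality using (_≡_; _≢_; refl; sym; trans; cong; subst)

lemma10 : (p : ℕ) → Prime p → p ≢ 2 → (a : ℕ) → a < p →
    ((i : ℕ) → (Ψ p i a ^ᴾ (p * p ∸ p)) ≡ᴾ one [mod p * p ])
    × ((i : ℕ) → 1 ≤ i → Ψ p i a ≡ᴾ Ψ p (i + 2) a [mod p * p ])
lemma10 zero          p-prime = ⊥-elim (¬prime[0] p-prime)
lemma10 (suc zero)    p-prime = ⊥-elim (¬prime[1] p-prime)
lemma10 p@(suc (suc q)) p-prime p≢2 a a<p = part-a , part-b
  where
  open PsiModSquare q p-prime
  q≢0 : q ≢ 0
  q≢0 refl = p≢2 refl
  p*p∸p≡[p-1]*p : p * p ∸ p ≡ suc q * p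
  p*p∸p≡[p-1]*p = trans (cong (p * p ∸_) (sym (*-identityˡ p))) (sym (*-distribʳ-∸ p p 1))
  part-a : (i : ℕ) → (Ψ p i a ^ᴾ (p * p ∸ p)) ≡ᴾ one [mod p * p ]
  part-a i = ≋⇒≡ᴾ (subst (λ n → (Ψ p i a ^ᴾ n) ≋ one [mod p * p ]) (sym p*p∸p≡[p-1]*p)
                         (Ψ^[p²-p]≋1 i a<p))
  part-b : (i : ℕ) → 1 ≤ i → Ψ p i a ≡ᴾ Ψ p (i + 2) a [mod p * p ]
  part-b (suc i) _ = ≋⇒≡ᴾ (subst (λ j → Ψ p (suc i) a ≋ Ψ p j a [mod p * p ]) (+-comm 2 (suc i))
                                 (Ψ-period q≢0 i a<p))
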